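{- Let $p$ be a prime, $G=\langle\sigma\rangle\simeq\mathbb{Z}/p^n\mathbb{Z}$, $A=\bigoplus_{i=1}^r\mathbb{F}_p[G]\alpha_i$ a finite $\mathbb{F}_p[G]$-module decomposed into cyclic submodules, and $\vec c\in\mathbb{F}_p^r$. Define $\vec d\in\mathbb{F}_p^r$ by $d_i=0$ if $\ell(\alpha_i)=p^n$ and $d_i=c_i$ otherwise. Then $\mathfrak{G}(A,\vec c)$ and $\mathfrak{G}(A,\vec d)$ are isomorphic as group-theoretic embedding problems over $G$.
   Context: $\ell(\alpha)=\dim_{\mathbb{F}_p}\mathbb{F}_p[G]\alpha$. $\mathfrak{G}(A,\vec c)$ is the group generated by $\alpha_1,\dots,\alpha_r,\hat\sigma$ subject to: $\alpha_i\alpha_j=\alpha_j\alpha_i$; $\hat\sigma\alpha_i\hat\sigma^{ -1}=\sigma\cdot\alpha_i$; $(\sigma-1)^{\ell(\alpha_i)}\alpha_i=0$ (the relations of the module $A$, whose addition is the group law); and $\hat\sigma^{p^n}=\sum_i c_i(\sigma-1)^{\ell(\alpha_i)-1}\alpha_i$; it comes with $\varphi:\mathfrak{G}(A,\vec c)\to G$, $\alpha_i\mapsto1$, $\hat\sigma\mapsto\sigma$. Two pairs $(\hat G_1,\varphi_1),(\hat G_2,\varphi_2)$ are isomorphic if there is a group isomorphism $\psi$ with $\varphi_2\circ\psi=\varphi_1$. -}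

module Defs where

open import Level using (0ℓ) renaming (suc to lsuc)
open import Data.Nat as ℕ using (ℕ; zero; suc; _<_; _∸_; _≟_)
open import Data.Integer as ℤ using (ℤ; +_)
open import Data.Integer.Divisibility as ℤd using ()
open import Data.Fin using (Fin)
open import Data.Product using (Σ; _×_)
open import Relation.Nullary using (yes; no)
open import Algebra.Bundles using (Group)
open import Algebra.Morphism.Structures using (IsGroupHomomorphism)

_≡ℤ_[mod_] : ℤ → ℤ → ℕ → Set
x ≡ℤ y [mod m ] = (+ m) ℤd.∣ (x ℤ.- y)

-- The module A = ⊕_{i<r} F_p[G] α_i with ℓ(α_i) = ℓ i.
-- Since G = ⟨σ⟩ is cyclic of p-power order, F_p[G] = F_p[T]/(T^{p^n}) with T = σ - 1,
-- and the cyclic module F_p[G] α_i is F_p[T]/(T^{ℓ i}), α_i ↦ 1.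
-- An element of A is represented by coefficients  x i k  (coefficient of T^k α_i),
-- read modulo p, and only for k < ℓ i.
ACarrier : ℕ → Set
ACarrier r = Fin r → ℕ → ℕ

EqA : (p r : ℕ) (ℓ : Fin r → ℕ) → ACarrier r → ACarrier r → Set
EqA p r ℓ x y = ∀ i k → k < ℓ i → (+ x i k) ≡ℤ (+ y i k) [mod p ]

addA : (r : ℕ) → ACarrier r → ACarrier r → ACarrier r
addA r x y i k = x i k ℕ.+ y i k

-- the action of σ = 1 + T
σA : (r : ℕ) → ACarrier r → ACarrier r
σA r x i zero    = x i zero
σA r x i (suc k) = x i (suc k) ℕ.+ x i k

-- the element  Σ_i c_i (σ-1)^{ℓ(α_i)-1} α_i = Σ_i c_i T^{ℓ i - 1} α_i
zA : (r : ℕ) (ℓ : Fin r → ℕ) (c : Fin r → ℕ) → ACarrier r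
zA r ℓ c i k with k ≟ (ℓ i ∸ 1)
... | yes _ = c i
... | no  _ = 0

dVec : (p n r : ℕ) (ℓ : Fin r → ℕ) (c : Fin r → ℕ) → Fin r → ℕ
dVec p n r ℓ c i with ℓ i ≟ (p ℕ.^ n)
... | yes _ = 0
... | no  _ = c i

pow : (K : Group 0ℓ 0ℓ) → Group.Carrier K → ℕ → Group.Carrier K
pow K g zero    = Group.ε K
pow K g (suc m) = Group._∙_ K g (pow K g m)

Relations : (p n r : ℕ) (ℓ : Fin r → ℕ) (c : Fin r → ℕ)
            (K : Group 0ℓ 0ℓ) → (ACarrier r → Group.Carrier K) → Group.Carrier K → Set
Relations p n r ℓ c K ι s =
    (∀ x y → EqA p r ℓ x y → ι x ≈ ι y)
  × (∀ x y → ι (addA r x y) ≈ (ι x ∙ ι y))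
  × (∀ x → ((s ∙ ι x) ∙ (s ⁻¹)) ≈ ι (σA r x))
  × (pow K s (p ℕ.^ n) ≈ ι (zA r ℓ c))
  where open Group K

-- (H, ι, s) is a presentation of 𝔊(A, c): the relations hold and it is universal
-- (initial) among groups with elements satisfying the relations.
IsPresentation : (p n r : ℕ) (ℓ : Fin r → ℕ) (c : Fin r → ℕ)
                 (H : Group 0ℓ 0ℓ) → (ACarrier r → Group.Carrier H) → Group.Carrier H → Set₁
IsPresentation p n r ℓ c H ι s =
    Relations p n r ℓ c H ι s
  × (∀ (K : Group 0ℓ 0ℓ) (ι′ : ACarrier r → Group.Carrier K) (s′ : Group.Carrier K) →
       Relations p n r ℓ c K ι′ s′ →
         (Σ (Group.Carrier H → Group.Carrier K) λ f →
              IsGroupHomomorphism (Group.rawGroup H) (Group.rawGroup K) f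
            × (∀ x → Group._≈_ K (f (ι x)) (ι′ x))
            × Group._≈_ K (f s) s′)
       × (∀ (f g : Group.Carrier H → Group.Carrier K) →
              IsGroupHomomorphism (Group.rawGroup H) (Group.rawGroup K) f →
              (∀ x → Group._≈_ K (f (ι x)) (ι′ x)) → Group._≈_ K (f s) s′ →
              IsGroupHomomorphism (Group.rawGroup H) (Group.rawGroup K) g →
              (∀ x → Group._≈_ K (g (ι x)) (ι′ x)) → Group._≈_ K (g s) s′ →
              ∀ h → Group._≈_ K (f h) (g h)))

-- φ : H → G = ℤ/p^nℤ (G written additively, σ ↦ 1) is a group homomorphism
-- with φ(ι a) = 0 and φ(s) = σ.
IsProjection : (p n r : ℕ) (H : Group 0ℓ 0ℓ) → (ACarrier r → Group.Carrier H) →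
               Group.Carrier H → (Group.Carrier H → ℤ) → Set
IsProjection p n r H ι s φ =
    (∀ x y → Group._≈_ H x y → φ x ≡ℤ φ y [mod p ℕ.^ n ])
  × (∀ x y → φ (Group._∙_ H x y) ≡ℤ (φ x ℤ.+ φ y) [mod p ℕ.^ n ])
  × (∀ a → φ (ι a) ≡ℤ (+ 0) [mod p ℕ.^ n ])
  × (φ s ≡ℤ (+ 1) [mod p ℕ.^ n ])

{-# OPTIONS --safe #-}
-- Replacing the lift σ̂ by a σ̂ with a ∈ A keeps every relation of 𝔊(A, c) but the last one,
-- because A is abelian, and (a σ̂)^{p^n} = N(a) σ̂^{p^n} with N = Σ_{j<p^n} σʲ. Writing σ = 1 + T,
-- the T^k-coefficient of N(αᵢ) is (p^n choose k+1), which is 1 modulo p for k = p^n - 1 and 0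
-- otherwise. So N kills the cyclic summands of length < p^n and sends αᵢ to T^{p^n-1} αᵢ on those
-- of full length: twisting by -Σ cᵢ αᵢ turns the relations for c into those for d, and twisting
-- by Σ cᵢ αᵢ turns them back. The universal properties then give mutually inverse homomorphisms,
-- and their compatibility with the maps to G follows from uniqueness as well.
module Submission where

open import Defs
open import Level using (0ℓ)
open import Data.Nat using (ℕ; zero; suc; pred; _+_; _*_; _∸_; _^_; _≤_; _<_; z≤n; s≤s; NonZero)
open import Data.Nat.Properties
open import Data.Nat.Divisibility using (_∣_; divides; _∣0; ∣-trans; m∣m*n; ∣n⇒∣m*n; *-cancelˡ-∣)
open import Data.Nat.Primality using (Prime; euclidsLemma; prime⇒nonZero)
open import Data.Nat.Combinatorics using (_C_; nC1≡n; nCn≡1; nCk+nC[k+1]≡[n+1]C[k+1])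
import Data.Nat.Tactic.RingSolver as ℕ-Solver
open import Data.Integer as ℤ using (ℤ; +_)
import Data.Integer.Properties as ℤP
open import Data.Integer.Divisibility.Signed as Signed using (∣ᵤ⇒∣; ∣⇒∣ᵤ; ∣m∣n⇒∣m+n; ∣m⇒∣-m)
import Data.Integer.Tactic.RingSolver as ℤ-Solver
open import Data.Fin using (Fin)
open import Data.Product using (Σ; _×_; _,_; proj₁; proj₂)
open import Data.Sum using (inj₁; inj₂)
open import Data.Empty using (⊥-elim)
open import Function using (_∘_; id)
open import Relation.Nullary using (¬_; yes; no)
open import Relation.Binary.PropositionalEquality as ≡ using (_≡_; refl; cong; cong₂; subst)
open import Algebra.Bundles using (Group)
open import Algebra.Morphism.Structures using (IsGroupHomomorphism; IsGroupIsomorphism)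
import Algebra.Morphism.Construct.Composition as Composition
import Algebra.Morphism.Construct.Identity as Identity
import Algebra.Properties.Group

[1+k]*[1+n]C[1+k]≡[1+n]*nCk : ∀ n k → suc k * (suc n C suc k) ≡ suc n * (n C k)
[1+k]*[1+n]C[1+k]≡[1+n]*nCk zero    zero    = refl
[1+k]*[1+n]C[1+k]≡[1+n]*nCk zero    (suc k) = *-zeroʳ (suc (suc k))
[1+k]*[1+n]C[1+k]≡[1+n]*nCk (suc n) zero    =
  ≡.trans (*-identityˡ _) (≡.trans (nC1≡n (suc (suc n))) (≡.sym (*-identityʳ _)))
[1+k]*[1+n]C[1+k]≡[1+n]*nCk (suc n) (suc k) = begin
  suc (suc k) * (suc (suc n) C suc (suc k))
    ≡⟨ cong (suc (suc k) *_) (nCk+nC[k+1]≡[n+1]C[k+1] (suc n) (suc k)) ⟨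
  suc (suc k) * (x + y)
    ≡⟨ distribute x y k ⟩
  x + (suc k * x + suc (suc k) * y)
    ≡⟨ cong (λ z → x + z) (cong₂ _+_ ([1+k]*[1+n]C[1+k]≡[1+n]*nCk n k) ([1+k]*[1+n]C[1+k]≡[1+n]*nCk n (suc k))) ⟩
  x + (suc n * (n C k) + suc n * (n C suc k))
    ≡⟨ cong (λ z → x + z) (*-distribˡ-+ (suc n) (n C k) (n C suc k)) ⟨
  x + suc n * (n C k + n C suc k)
    ≡⟨ cong (λ z → x + suc n * z) (nCk+nC[k+1]≡[n+1]C[k+1] n k) ⟩
  suc (suc n) * x ∎
  where
  open ≡.≡-Reasoning
  x y : ℕ
  x = suc n C suc k
  y = suc n C suc (suc k)
  distribute : ∀ x y k → suc (suc k) * (x + y) ≡ x + (suc k * x + suc (suc k) * y)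
  distribute = ℕ-Solver.solve-∀

n∣[1+k]*nC[1+k] : ∀ n k → n ∣ suc k * (n C suc k)
n∣[1+k]*nC[1+k] zero    k = subst (0 ∣_) (≡.sym (*-zeroʳ (suc k))) (0 ∣0)
n∣[1+k]*nC[1+k] (suc n) k =
  divides (n C k) (≡.trans ([1+k]*[1+n]C[1+k]≡[1+n]*nCk n k) (*-comm (suc n) (n C k)))

module _ {p : ℕ} (p-prime : Prime p) where

  private instance
    p≢0 : NonZero p
    p≢0 = prime⇒nonZero p-prime

  p^n∣k*m⇒p∣m : ∀ n {k m} → 0 < k → k < p ^ n → p ^ n ∣ k * m → p ∣ m
  p^n∣k*m⇒p∣m zero    (s≤s _) (s≤s ())
  p^n∣k*m⇒p∣m (suc n) {k} {m} 0<k k<p^[1+n] p^[1+n]∣k*m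
    with euclidsLemma k m p-prime (∣-trans (m∣m*n (p ^ n)) p^[1+n]∣k*m)
  ... | inj₂ p∣m = p∣m
  ... | inj₁ (divides q refl) = p^n∣k*m⇒p∣m n 0<q q<p^n p^n∣q*m
    where
    0<q : 0 < q
    0<q = *-cancelʳ-< p 0 q 0<k
    q<p^n : q < p ^ n
    q<p^n = *-cancelʳ-< p q (p ^ n) (subst (q * p <_) (*-comm p (p ^ n)) k<p^[1+n])
    p^n∣q*m : p ^ n ∣ q * m
    p^n∣q*m = *-cancelˡ-∣ p (subst (p * p ^ n ∣_) (rearrange q p m) p^[1+n]∣k*m)
      where
      rearrange : ∀ q p m → q * p * m ≡ p * (q * m)
      rearrange = ℕ-Solver.solve-∀

  p∣p^nC[1+k] : ∀ n k → suc k < p ^ n → p ∣ p ^ n C suc k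
  p∣p^nC[1+k] n k 1+k<p^n = p^n∣k*m⇒p∣m n (s≤s z≤n) 1+k<p^n (n∣[1+k]*nC[1+k] (p ^ n) k)

module _ (H K : Group 0ℓ 0ℓ) where

  private
    module H = Group H
    module K = Group K

  ∙-homo⇒isGroupHomomorphism : (f : H.Carrier → K.Carrier) →
    (∀ x y → x H.≈ y → f x K.≈ f y) → (∀ x y → f (x H.∙ y) K.≈ f x K.∙ f y) →
    IsGroupHomomorphism H.rawGroup K.rawGroup f
  ∙-homo⇒isGroupHomomorphism f f-cong f-homo = record
    { isMonoidHomomorphism = record
      { isMagmaHomomorphism = record
        { isRelHomomorphism = record { cong = f-cong _ _ }
        ; homo = f-homo
        }
      ; ε-homo = f-ε
      }
    ; ⁻¹-homo = λ x → KP.inverseˡ-unique (f (x H.⁻¹)) (f x)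
        (K.trans (K.sym (f-homo _ _)) (K.trans (f-cong _ _ (H.inverseˡ x)) f-ε))
    }
    where
    module KP = Algebra.Properties.Group K
    f-ε : f H.ε K.≈ K.ε
    f-ε = KP.identityʳ-unique _ _ (K.trans (K.sym (f-homo H.ε H.ε)) (f-cong _ _ (H.identityˡ H.ε)))

  inverses⇒isGroupIsomorphism : ∀ {f g} →
    IsGroupHomomorphism H.rawGroup K.rawGroup f → IsGroupHomomorphism K.rawGroup H.rawGroup g →
    (∀ x → g (f x) H.≈ x) → (∀ y → f (g y) K.≈ y) →
    IsGroupIsomorphism H.rawGroup K.rawGroup f
  inverses⇒isGroupIsomorphism {f} {g} f-hom g-hom g∘f≈id f∘g≈id = record
    { isGroupMonomorphism = record
      { isGroupHomomorphism = f-hom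
      ; injective = λ {x} {y} fx≈fy →
          H.trans (H.sym (g∘f≈id x)) (H.trans (G.⟦⟧-cong fx≈fy) (g∘f≈id y))
      }
    ; surjective = λ y → g y , λ z≈gy → K.trans (F.⟦⟧-cong z≈gy) (f∘g≈id y)
    }
    where
    module F = IsGroupHomomorphism f-hom
    module G = IsGroupHomomorphism g-hom

module Modulo (m : ℕ) where

  ≡-mod⇒∣ : ∀ {x y} → x ≡ℤ y [mod m ] → (+ m) Signed.∣ (x ℤ.- y)
  ≡-mod⇒∣ {x} {y} = ∣ᵤ⇒∣ {+ m} {x ℤ.- y}

  ∣⇒≡-mod : ∀ {x y} → (+ m) Signed.∣ (x ℤ.- y) → x ≡ℤ y [mod m ]
  ∣⇒≡-mod {x} {y} = ∣⇒∣ᵤ {+ m} {x ℤ.- y}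

  ≡-mod-reflexive : ∀ {x y} → x ≡ y → x ≡ℤ y [mod m ]
  ≡-mod-reflexive {x} refl = ∣⇒≡-mod {x} {x} (Signed.divides (+ 0) (ℤP.+-inverseʳ x))

  ≡-mod-sym : ∀ {x y} → x ≡ℤ y [mod m ] → y ≡ℤ x [mod m ]
  ≡-mod-sym {x} {y} x≡y =
    ∣⇒≡-mod {y} {x} (subst (Signed._∣_ (+ m)) (negate x y) (∣m⇒∣-m (≡-mod⇒∣ {x} {y} x≡y)))
    where
    negate : ∀ x y → ℤ.- (x ℤ.- y) ≡ y ℤ.- x
    negate = ℤ-Solver.solve-∀

  ≡-mod-trans : ∀ {x y z} → x ≡ℤ y [mod m ] → y ≡ℤ z [mod m ] → x ≡ℤ z [mod m ]
  ≡-mod-trans {x} {y} {z} x≡y y≡z = ∣⇒≡-mod {x} {z} (subst (Signed._∣_ (+ m)) (telescope x y z)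
    (∣m∣n⇒∣m+n (≡-mod⇒∣ {x} {y} x≡y) (≡-mod⇒∣ {y} {z} y≡z)))
    where
    telescope : ∀ x y z → (x ℤ.- y) ℤ.+ (y ℤ.- z) ≡ x ℤ.- z
    telescope = ℤ-Solver.solve-∀

  ≡-mod-+-cong : ∀ {x y u v} → x ≡ℤ y [mod m ] → u ≡ℤ v [mod m ] →
                 (x ℤ.+ u) ≡ℤ (y ℤ.+ v) [mod m ]
  ≡-mod-+-cong {x} {y} {u} {v} x≡y u≡v = ∣⇒≡-mod {x ℤ.+ u} {y ℤ.+ v}
    (subst (Signed._∣_ (+ m)) (interchange x y u v)
      (∣m∣n⇒∣m+n (≡-mod⇒∣ {x} {y} x≡y) (≡-mod⇒∣ {u} {v} u≡v)))
    where
    interchange : ∀ x y u v → (x ℤ.- y) ℤ.+ (u ℤ.- v) ≡ (x ℤ.+ u) ℤ.- (y ℤ.+ v)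
    interchange = ℤ-Solver.solve-∀

  ≡-mod-neg-cong : ∀ {x y} → x ≡ℤ y [mod m ] → (ℤ.- x) ≡ℤ (ℤ.- y) [mod m ]
  ≡-mod-neg-cong {x} {y} x≡y = ∣⇒≡-mod {ℤ.- x} {ℤ.- y}
    (subst (Signed._∣_ (+ m)) (negate x y) (∣m⇒∣-m (≡-mod⇒∣ {x} {y} x≡y)))
    where
    negate : ∀ x y → ℤ.- (x ℤ.- y) ≡ (ℤ.- x) ℤ.- (ℤ.- y)
    negate = ℤ-Solver.solve-∀

  m∣x⇒x+y≡y : ∀ {x} y → m ∣ x → (+ (x + y)) ≡ℤ (+ y) [mod m ]
  m∣x⇒x+y≡y {x} y m∣x = subst (m ∣_) (≡.sym distance) m∣x
    where
    distance : ℤ.∣ + (x + y) ℤ.- + y ∣ ≡ x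
    distance = ≡.trans (cong ℤ.∣_∣ (≡.trans (ℤP.m-n≡m⊖n (x + y) y) (ℤP.⊖-≥ (m≤n+m y x))))
                       (m+n∸n≡m x y)

  m≡0 : (+ m) ≡ℤ (+ 0) [mod m ]
  m≡0 = divides 1 refl

  ℤ/m : Group 0ℓ 0ℓ
  ℤ/m = record
    { Carrier = ℤ
    ; _≈_     = λ x y → x ≡ℤ y [mod m ]
    ; _∙_     = ℤ._+_
    ; ε       = + 0
    ; _⁻¹     = ℤ.-_
    ; isGroup = record
      { isMonoid = record
        { isSemigroup = record
          { isMagma = record
            { isEquivalence = record
              { refl  = λ {x} → ≡-mod-reflexive {x} refl
              ; sym   = λ {x} {y} → ≡-mod-sym {x} {y}
              ; trans = λ {x} {y} {z} → ≡-mod-trans {x} {y} {z}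
              }
            ; ∙-cong = λ {x} {y} {u} {v} → ≡-mod-+-cong {x} {y} {u} {v}
            }
          ; assoc = λ x y z → ≡-mod-reflexive (ℤP.+-assoc x y z)
          }
        ; identity = (λ x → ≡-mod-reflexive (ℤP.+-identityˡ x)) , (λ x → ≡-mod-reflexive (ℤP.+-identityʳ x))
        }
      ; inverse = (λ x → ≡-mod-reflexive (ℤP.+-inverseˡ x)) , (λ x → ≡-mod-reflexive (ℤP.+-inverseʳ x))
      ; ⁻¹-cong = λ {x} {y} → ≡-mod-neg-cong {x} {y}
      }
    }

  pow-1≡k : ∀ k → pow ℤ/m (+ 1) k ≡ + k
  pow-1≡k zero    = refl
  pow-1≡k (suc k) = cong (ℤ._+_ (+ 1)) (pow-1≡k k)

zeroA : (r : ℕ) → ACarrier r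
zeroA r i k = 0

gen : (r : ℕ) → (Fin r → ℕ) → ACarrier r
gen r w i zero    = w i
gen r w i (suc k) = 0

normA : (r : ℕ) → ℕ → ACarrier r → ACarrier r
normA r zero    a = zeroA r
normA r (suc m) a = addA r a (σA r (normA r m a))

-- Since σ = 1 + T, this is the hockey-stick identity Σ_{j<m} (j choose k) = (m choose k+1).
normA-gen : ∀ r m w i k → normA r m (gen r w) i k ≡ w i * (m C suc k)
normA-gen r zero    w i k       = ≡.sym (*-zeroʳ (w i))
normA-gen r (suc m) w i zero    = begin
  w i + normA r m (gen r w) i 0 ≡⟨ cong (_+_ (w i)) (normA-gen r m w i 0) ⟩
  w i + w i * (m C 1)           ≡⟨ *-suc (w i) (m C 1) ⟨
  w i * suc (m C 1)             ≡⟨ cong (w i *_) (nCk+nC[k+1]≡[n+1]C[k+1] m 0) ⟩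
  w i * (suc m C 1)             ∎
  where open ≡.≡-Reasoning
normA-gen r (suc m) w i (suc k) = begin
  normA r m (gen r w) i (suc k) + normA r m (gen r w) i k
    ≡⟨ cong₂ _+_ (normA-gen r m w i (suc k)) (normA-gen r m w i k) ⟩
  w i * (m C suc (suc k)) + w i * (m C suc k)
    ≡⟨ +-comm (w i * (m C suc (suc k))) (w i * (m C suc k)) ⟩
  w i * (m C suc k) + w i * (m C suc (suc k))
    ≡⟨ *-distribˡ-+ (w i) (m C suc k) (m C suc (suc k)) ⟨
  w i * (m C suc k + m C suc (suc k))
    ≡⟨ cong (w i *_) (nCk+nC[k+1]≡[n+1]C[k+1] m (suc k)) ⟩
  w i * (suc m C suc (suc k)) ∎
  where open ≡.≡-Reasoning

EqA-reflexive : ∀ {p r ℓ} {x y : ACarrier r} → (∀ i k → x i k ≡ y i k) → EqA p r ℓ x y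
EqA-reflexive {p} x≗y i k _ = Modulo.≡-mod-reflexive p (cong +_ (x≗y i k))

-- Twisting the lift σ̂ by a turns the relation σ̂^{p^n} = zA c into (a σ̂)^{p^n} = zA c′.
Twists : (p n r : ℕ) (ℓ : Fin r → ℕ) → ACarrier r → (c c′ : Fin r → ℕ) → Set
Twists p n r ℓ a c c′ = EqA p r ℓ (addA r (normA r (p ^ n) a) (zA r ℓ c)) (zA r ℓ c′)

module Twisting {p n r : ℕ} {ℓ : Fin r → ℕ} {c : Fin r → ℕ} (K : Group 0ℓ 0ℓ)
                {ι : ACarrier r → Group.Carrier K} {s : Group.Carrier K}
                (rel : Relations p n r ℓ c K ι s) where

  open Group K
  open import Algebra.Properties.Group K using (identityʳ-unique; ⁻¹-anti-homo-∙)
  open import Relation.Binary.Reasoning.Setoid setoid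

  private
    ι-resp : ∀ x y → EqA p r ℓ x y → ι x ≈ ι y
    ι-resp = proj₁ rel
    ι-homo : ∀ x y → ι (addA r x y) ≈ ι x ∙ ι y
    ι-homo = proj₁ (proj₂ rel)
    s-conj : ∀ x → (s ∙ ι x) ∙ s ⁻¹ ≈ ι (σA r x)
    s-conj = proj₁ (proj₂ (proj₂ rel))
    s-pow : pow K s (p ^ n) ≈ ι (zA r ℓ c)
    s-pow = proj₂ (proj₂ (proj₂ rel))

  ι-zero : ι (zeroA r) ≈ ε
  ι-zero = identityʳ-unique _ _ (sym (ι-homo (zeroA r) (zeroA r)))

  ι-comm : ∀ x y → ι x ∙ ι y ≈ ι y ∙ ι x
  ι-comm x y = begin
    ι x ∙ ι y      ≈⟨ ι-homo x y ⟨
    ι (addA r x y) ≈⟨ ι-resp _ _ (EqA-reflexive (λ i k → +-comm (x i k) (y i k))) ⟩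
    ι (addA r y x) ≈⟨ ι-homo y x ⟩
    ι y ∙ ι x      ∎

  s∙ι≈ισ∙s : ∀ x → s ∙ ι x ≈ ι (σA r x) ∙ s
  s∙ι≈ισ∙s x = begin
    s ∙ ι x                   ≈⟨ identityʳ _ ⟨
    (s ∙ ι x) ∙ ε             ≈⟨ ∙-congˡ (inverseˡ s) ⟨
    (s ∙ ι x) ∙ (s ⁻¹ ∙ s)    ≈⟨ assoc _ _ _ ⟨
    ((s ∙ ι x) ∙ s ⁻¹) ∙ s    ≈⟨ ∙-congʳ (s-conj x) ⟩
    ι (σA r x) ∙ s            ∎

  pow-twist : ∀ m a → pow K (ι a ∙ s) m ≈ ι (normA r m a) ∙ pow K s m
  pow-twist zero    a = sym (trans (identityʳ _) ι-zero)
  pow-twist (suc m) a = begin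
    (ι a ∙ s) ∙ pow K (ι a ∙ s) m            ≈⟨ ∙-congˡ (pow-twist m a) ⟩
    (ι a ∙ s) ∙ (ι N ∙ pow K s m)            ≈⟨ assoc _ _ _ ⟩
    ι a ∙ (s ∙ (ι N ∙ pow K s m))            ≈⟨ ∙-congˡ (assoc _ _ _) ⟨
    ι a ∙ ((s ∙ ι N) ∙ pow K s m)            ≈⟨ ∙-congˡ (∙-congʳ (s∙ι≈ισ∙s N)) ⟩
    ι a ∙ ((ι (σA r N) ∙ s) ∙ pow K s m)     ≈⟨ ∙-congˡ (assoc _ _ _) ⟩
    ι a ∙ (ι (σA r N) ∙ (s ∙ pow K s m))     ≈⟨ assoc _ _ _ ⟨
    (ι a ∙ ι (σA r N)) ∙ (s ∙ pow K s m)     ≈⟨ ∙-congʳ (ι-homo a (σA r N)) ⟨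
    ι (normA r (suc m) a) ∙ pow K s (suc m)  ∎
    where
    N : ACarrier r
    N = normA r m a

  twist : ∀ {a c′} → Twists p n r ℓ a c c′ → Relations p n r ℓ c′ K ι (ι a ∙ s)
  twist {a} {c′} twists = ι-resp , ι-homo , conj , power
    where
    conj : ∀ x → ((ι a ∙ s) ∙ ι x) ∙ (ι a ∙ s) ⁻¹ ≈ ι (σA r x)
    conj x = begin
      ((ι a ∙ s) ∙ ι x) ∙ (ι a ∙ s) ⁻¹         ≈⟨ ∙-cong (assoc _ _ _) (⁻¹-anti-homo-∙ (ι a) s) ⟩
      (ι a ∙ (s ∙ ι x)) ∙ (s ⁻¹ ∙ ι a ⁻¹)      ≈⟨ assoc _ _ _ ⟩
      ι a ∙ ((s ∙ ι x) ∙ (s ⁻¹ ∙ ι a ⁻¹))      ≈⟨ ∙-congˡ (assoc _ _ _) ⟨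
      ι a ∙ (((s ∙ ι x) ∙ s ⁻¹) ∙ ι a ⁻¹)      ≈⟨ ∙-congˡ (∙-congʳ (s-conj x)) ⟩
      ι a ∙ (ι (σA r x) ∙ ι a ⁻¹)              ≈⟨ assoc _ _ _ ⟨
      (ι a ∙ ι (σA r x)) ∙ ι a ⁻¹              ≈⟨ ∙-congʳ (ι-comm a (σA r x)) ⟩
      (ι (σA r x) ∙ ι a) ∙ ι a ⁻¹              ≈⟨ assoc _ _ _ ⟩
      ι (σA r x) ∙ (ι a ∙ ι a ⁻¹)              ≈⟨ ∙-congˡ (inverseʳ (ι a)) ⟩
      ι (σA r x) ∙ ε                           ≈⟨ identityʳ _ ⟩
      ι (σA r x)                               ∎
    power : pow K (ι a ∙ s) (p ^ n) ≈ ι (zA r ℓ c′)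
    power = begin
      pow K (ι a ∙ s) (p ^ n)                        ≈⟨ pow-twist (p ^ n) a ⟩
      ι (normA r (p ^ n) a) ∙ pow K s (p ^ n)        ≈⟨ ∙-congˡ s-pow ⟩
      ι (normA r (p ^ n) a) ∙ ι (zA r ℓ c)           ≈⟨ ι-homo _ _ ⟨
      ι (addA r (normA r (p ^ n) a) (zA r ℓ c))      ≈⟨ ι-resp _ _ twists ⟩
      ι (zA r ℓ c′)                                  ∎

  ι-inverse : ∀ {a b} → EqA p r ℓ (addA r a b) (zeroA r) → ι a ∙ ι b ≈ ε
  ι-inverse {a} {b} a+b≡0 = trans (sym (ι-homo a b)) (trans (ι-resp _ _ a+b≡0) ι-zero)

  untwist : ∀ {a b} → ι a ∙ ι b ≈ ε → ι a ∙ (ι b ∙ s) ≈ s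
  untwist {a} {b} ιa∙ιb≈ε = trans (sym (assoc _ _ _)) (trans (∙-congʳ ιa∙ιb≈ε) (identityˡ s))

module _ {p n r : ℕ} {ℓ : Fin r → ℕ} {c : Fin r → ℕ}
         {H : Group 0ℓ 0ℓ} {ι : ACarrier r → Group.Carrier H} {s : Group.Carrier H}
         (pres : IsPresentation p n r ℓ c H ι s) where

  private
    module H = Group H

  fixesGenerators⇒≈id : (h : H.Carrier → H.Carrier) → IsGroupHomomorphism H.rawGroup H.rawGroup h →
    (∀ x → h (ι x) H.≈ ι x) → h s H.≈ s → ∀ x → h x H.≈ x
  fixesGenerators⇒≈id h h-hom hι≈ι hs≈s =
    proj₂ (proj₂ pres H ι s (proj₁ pres)) h id h-hom hι≈ι hs≈s
      (Identity.isGroupHomomorphism H.rawGroup H.refl) (λ _ → H.refl) H.refl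

module _ {p n r : ℕ} {ℓ : Fin r → ℕ} {c c′ : Fin r → ℕ}
         {H₁ : Group 0ℓ 0ℓ} {ι₁ : ACarrier r → Group.Carrier H₁} {s₁ : Group.Carrier H₁}
         {H₂ : Group 0ℓ 0ℓ} {ι₂ : ACarrier r → Group.Carrier H₂} {s₂ : Group.Carrier H₂}
         (pres₁ : IsPresentation p n r ℓ c H₁ ι₁ s₁) (pres₂ : IsPresentation p n r ℓ c′ H₂ ι₂ s₂)
         (a b : ACarrier r) (a-twists : Twists p n r ℓ a c c′) (b-twists : Twists p n r ℓ b c′ c)
         (a+b≡0 : EqA p r ℓ (addA r a b) (zeroA r)) where

  private
    module H₁ = Group H₁
    module H₂ = Group H₂
    module T₁ = Twisting {n = n} H₁ (proj₁ pres₁)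
    module T₂ = Twisting {n = n} H₂ (proj₁ pres₂)

  twistIsomorphism : Σ (H₁.Carrier → H₂.Carrier) λ ψ →
      IsGroupIsomorphism H₁.rawGroup H₂.rawGroup ψ
    × (∀ x → ψ (ι₁ x) H₂.≈ ι₂ x) × ψ s₁ H₂.≈ ι₂ b H₂.∙ s₂
  twistIsomorphism
    with proj₁ (proj₂ pres₁ H₂ ι₂ (ι₂ b H₂.∙ s₂) (T₂.twist b-twists))
       | proj₁ (proj₂ pres₂ H₁ ι₁ (ι₁ a H₁.∙ s₁) (T₁.twist a-twists))
  ... | f , f-hom , fι , fs | g , g-hom , gι , gs =
    f , inverses⇒isGroupIsomorphism H₁ H₂ f-hom g-hom g∘f≈id f∘g≈id , fι , fs
    where
    module F = IsGroupHomomorphism f-hom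
    module G = IsGroupHomomorphism g-hom

    g∘f≈id : ∀ x → g (f x) H₁.≈ x
    g∘f≈id = fixesGenerators⇒≈id {n = n} pres₁ (g ∘ f) (Composition.isGroupHomomorphism H₁.trans f-hom g-hom)
      (λ x → H₁.trans (G.⟦⟧-cong (fι x)) (gι x))
      (begin
        g (f s₁)                  ≈⟨ G.⟦⟧-cong fs ⟩
        g (ι₂ b H₂.∙ s₂)          ≈⟨ G.homo _ _ ⟩
        g (ι₂ b) H₁.∙ g s₂        ≈⟨ H₁.∙-cong (gι b) gs ⟩
        ι₁ b H₁.∙ (ι₁ a H₁.∙ s₁)  ≈⟨ T₁.untwist (H₁.trans (T₁.ι-comm b a) (T₁.ι-inverse a+b≡0)) ⟩
        s₁                        ∎)
      where open import Relation.Binary.Reasoning.Setoid H₁.setoid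

    f∘g≈id : ∀ y → f (g y) H₂.≈ y
    f∘g≈id = fixesGenerators⇒≈id {n = n} pres₂ (f ∘ g) (Composition.isGroupHomomorphism H₂.trans g-hom f-hom)
      (λ x → H₂.trans (F.⟦⟧-cong (gι x)) (fι x))
      (begin
        f (g s₂)                  ≈⟨ F.⟦⟧-cong gs ⟩
        f (ι₁ a H₁.∙ s₁)          ≈⟨ F.homo _ _ ⟩
        f (ι₁ a) H₂.∙ f s₁        ≈⟨ H₂.∙-cong (fι a) fs ⟩
        ι₂ a H₂.∙ (ι₂ b H₂.∙ s₂)  ≈⟨ T₂.untwist (T₂.ι-inverse a+b≡0) ⟩
        s₂                        ∎)
      where open import Relation.Binary.Reasoning.Setoid H₂.setoid

module _ {p n r : ℕ} {ℓ : Fin r → ℕ} {c : Fin r → ℕ} where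

  open Modulo (p ^ n) using (ℤ/m; m≡0; pow-1≡k)

  private
    module ℤ/m = Group ℤ/m

  projectionRelations : Relations p n r ℓ c ℤ/m (λ _ → + 0) (+ 1)
  projectionRelations =
      (λ _ _ _ → ℤ/m.refl {+ 0})
    , (λ _ _ → ℤ/m.refl {+ 0})
    , (λ _ → ℤ/m.refl {+ 0})
    , subst (ℤ/m._≈ + 0) (≡.sym (pow-1≡k (p ^ n))) m≡0

  module _ {H : Group 0ℓ 0ℓ} {ι : ACarrier r → Group.Carrier H} {s : Group.Carrier H}
           (pres : IsPresentation p n r ℓ c H ι s) where

    private
      module H = Group H

    projection-compatible : ∀ φ₁ → IsProjection p n r H ι s φ₁ →
      ∀ {H₂ : Group 0ℓ 0ℓ} {ι₂ : ACarrier r → Group.Carrier H₂} {s₂ : Group.Carrier H₂} φ₂ →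
      IsProjection p n r H₂ ι₂ s₂ φ₂ →
      ∀ {ψ b} → IsGroupHomomorphism H.rawGroup (Group.rawGroup H₂) ψ →
      (∀ x → Group._≈_ H₂ (ψ (ι x)) (ι₂ x)) → Group._≈_ H₂ (ψ s) (Group._∙_ H₂ (ι₂ b) s₂) →
      ∀ x → φ₂ (ψ x) ℤ/m.≈ φ₁ x
    projection-compatible φ₁ (φ₁-cong , φ₁-homo , φ₁ι , φ₁s) {H₂} {ι₂} {s₂} φ₂
                          (φ₂-cong , φ₂-homo , φ₂ι , φ₂s) {ψ} {b} ψ-hom ψι ψs =
      proj₂ (proj₂ pres ℤ/m (λ _ → + 0) (+ 1) projectionRelations)
        (φ₂ ∘ ψ) φ₁ φ₂∘ψ-hom φ₂∘ψ∘ι≈0 φ₂∘ψ-s≈1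
        (∙-homo⇒isGroupHomomorphism H ℤ/m φ₁ φ₁-cong φ₁-homo) φ₁ι φ₁s
      where
      module H₂ = Group H₂
      open import Relation.Binary.Reasoning.Setoid ℤ/m.setoid
      φ₂∘ψ-hom : IsGroupHomomorphism H.rawGroup ℤ/m.rawGroup (φ₂ ∘ ψ)
      φ₂∘ψ-hom = Composition.isGroupHomomorphism (λ {i j k} → ℤ/m.trans {i} {j} {k}) ψ-hom
                   (∙-homo⇒isGroupHomomorphism H₂ ℤ/m φ₂ φ₂-cong φ₂-homo)
      φ₂∘ψ∘ι≈0 : ∀ x → φ₂ (ψ (ι x)) ℤ/m.≈ + 0
      φ₂∘ψ∘ι≈0 x = ℤ/m.trans {φ₂ (ψ (ι x))} {φ₂ (ι₂ x)} {+ 0} (φ₂-cong _ _ (ψι x)) (φ₂ι x)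
      φ₂∘ψ-s≈1 : φ₂ (ψ s) ℤ/m.≈ + 1
      φ₂∘ψ-s≈1 = begin
        φ₂ (ψ s)                  ≈⟨ φ₂-cong _ _ ψs ⟩
        φ₂ (ι₂ b H₂.∙ s₂)         ≈⟨ φ₂-homo _ _ ⟩
        φ₂ (ι₂ b) ℤ.+ φ₂ s₂       ≈⟨ ℤ/m.∙-cong {φ₂ (ι₂ b)} {+ 0} {φ₂ s₂} {+ 1} (φ₂ι b) φ₂s ⟩
        + 1                       ∎

k≡l∸1⇒1+k≡l : ∀ {k l} → k < l → k ≡ l ∸ 1 → suc k ≡ l
k≡l∸1⇒1+k≡l {l = suc l} _ refl = refl

module _ {p : ℕ} (p-prime : Prime p) where

  open Modulo p using (≡-mod-reflexive; m∣x⇒x+y≡y)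

  private
    module ℤ/p = Group (Modulo.ℤ/m p)

  [p-1]x+x≡0 : ∀ x → (+ (pred p * x + x)) ≡ℤ (+ 0) [mod p ]
  [p-1]x+x≡0 x = subst (λ z → (+ z) ≡ℤ (+ 0) [mod p ]) px≡[p-1]x+x (m∣x⇒x+y≡y 0 (m∣m*n x))
    where
    px≡[p-1]x+x : p * x + 0 ≡ pred p * x + x
    px≡[p-1]x+x = ≡.trans (+-identityʳ (p * x))
      (≡.trans (cong (_* x) (≡.sym (suc-pred p {{prime⇒nonZero p-prime}}))) (+-comm x (pred p * x)))

  module _ {n r : ℕ} {ℓ : Fin r → ℕ} (ℓ≤p^n : ∀ i → ℓ i ≤ p ^ n) where

    gen-twists : ∀ u c c′ →
      (∀ i → ℓ i ≡ p ^ n → (+ (u i + c i)) ≡ℤ (+ c′ i) [mod p ]) →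
      (∀ i → ¬ ℓ i ≡ p ^ n → (+ c i) ≡ℤ (+ c′ i) [mod p ]) →
      Twists p n r ℓ (gen r u) c c′
    gen-twists u c c′ full-step partial-step i k k<ℓ = begin
      + (normA r (p ^ n) (gen r u) i k + zA r ℓ c i k)
        ≈⟨ ≡-mod-reflexive (cong (λ z → + (z + zA r ℓ c i k)) (normA-gen r (p ^ n) u i k)) ⟩
      + (u i * (p ^ n C suc k) + zA r ℓ c i k)
        ≈⟨ coefficient ⟩
      + zA r ℓ c′ i k ∎
      where
      open import Relation.Binary.Reasoning.Setoid ℤ/p.setoid
      p∣u*C : suc k < p ^ n → p ∣ u i * (p ^ n C suc k)
      p∣u*C 1+k<p^n = ∣n⇒∣m*n (u i) (p∣p^nC[1+k] p-prime n k 1+k<p^n)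
      partial⇒1+k<p^n : ¬ ℓ i ≡ p ^ n → suc k < p ^ n
      partial⇒1+k<p^n partial = ≤-<-trans k<ℓ (≤∧≢⇒< (ℓ≤p^n i) partial)
      coefficient : (+ (u i * (p ^ n C suc k) + zA r ℓ c i k)) ≡ℤ (+ zA r ℓ c′ i k) [mod p ]
      coefficient with ℓ i ≟ p ^ n | k ≟ ℓ i ∸ 1
      ... | yes full | yes k≡ℓ-1 = begin
        + (u i * (p ^ n C suc k) + c i) ≈⟨ ≡-mod-reflexive (cong (λ z → + (z + c i)) u*C≡u) ⟩
        + (u i + c i)                   ≈⟨ full-step i full ⟩
        + c′ i                          ∎
        where
        u*C≡u : u i * (p ^ n C suc k) ≡ u i
        u*C≡u = ≡.trans (cong (λ m → u i * (p ^ n C m)) (≡.trans (k≡l∸1⇒1+k≡l k<ℓ k≡ℓ-1) full))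
                        (≡.trans (cong (u i *_) (nCn≡1 (p ^ n))) (*-identityʳ (u i)))
      ... | yes full | no  k≢ℓ-1 = m∣x⇒x+y≡y 0 (p∣u*C (≤∧≢⇒< (subst (suc k ≤_) full k<ℓ)
                                     λ 1+k≡p^n → k≢ℓ-1 (cong (_∸ 1) (≡.trans 1+k≡p^n (≡.sym full)))))
      ... | no partial | yes _ = begin
        + (u i * (p ^ n C suc k) + c i) ≈⟨ m∣x⇒x+y≡y (c i) (p∣u*C (partial⇒1+k<p^n partial)) ⟩
        + c i                           ≈⟨ partial-step i partial ⟩
        + c′ i                          ∎
      ... | no partial | no  _ = m∣x⇒x+y≡y 0 (p∣u*C (partial⇒1+k<p^n partial))

    module _ (c : Fin r → ℕ) where

      private
        d : Fin r → ℕ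
        d = dVec p n r ℓ c
        -c : Fin r → ℕ
        -c i = pred p * c i

        dVec-full : ∀ {i} → ℓ i ≡ p ^ n → d i ≡ 0
        dVec-full {i} full with ℓ i ≟ p ^ n
        ... | yes _       = refl
        ... | no  partial = ⊥-elim (partial full)

        dVec-partial : ∀ {i} → ¬ ℓ i ≡ p ^ n → d i ≡ c i
        dVec-partial {i} partial with ℓ i ≟ p ^ n
        ... | yes full = ⊥-elim (partial full)
        ... | no  _    = refl

      -c-twists-c-to-d : Twists p n r ℓ (gen r -c) c d
      -c-twists-c-to-d = gen-twists -c c d full partial
        where
        full : ∀ i → ℓ i ≡ p ^ n → (+ (-c i + c i)) ≡ℤ (+ d i) [mod p ]
        full i ℓᵢ≡p^n = subst (λ z → (+ (-c i + c i)) ≡ℤ (+ z) [mod p ]) (≡.sym (dVec-full ℓᵢ≡p^n))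
                              ([p-1]x+x≡0 (c i))
        partial : ∀ i → ¬ ℓ i ≡ p ^ n → (+ c i) ≡ℤ (+ d i) [mod p ]
        partial i ℓᵢ≢p^n = ≡-mod-reflexive (cong +_ (≡.sym (dVec-partial ℓᵢ≢p^n)))

      c-twists-d-to-c : Twists p n r ℓ (gen r c) d c
      c-twists-d-to-c = gen-twists c d c full partial
        where
        full : ∀ i → ℓ i ≡ p ^ n → (+ (c i + d i)) ≡ℤ (+ c i) [mod p ]
        full i ℓᵢ≡p^n =
          ≡-mod-reflexive (cong +_ (≡.trans (cong (_+_ (c i)) (dVec-full ℓᵢ≡p^n)) (+-identityʳ (c i))))
        partial : ∀ i → ¬ ℓ i ≡ p ^ n → (+ d i) ≡ℤ (+ c i) [mod p ]
        partial i ℓᵢ≢p^n = ≡-mod-reflexive (cong +_ (dVec-partial ℓᵢ≢p^n))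

      gen[-c]+gen[c]≡0 : EqA p r ℓ (addA r (gen r -c) (gen r c)) (zeroA r)
      gen[-c]+gen[c]≡0 i zero    _ = [p-1]x+x≡0 (c i)
      gen[-c]+gen[c]≡0 i (suc k) _ = ≡-mod-reflexive {+ 0} refl

lemma3p3 : (p n r : ℕ) → Prime p →
    (ℓ : Fin r → ℕ) → (∀ i → 1 ≤ ℓ i) → (∀ i → ℓ i ≤ p ^ n) →
    (c : Fin r → ℕ) →
    (H₁ : Group 0ℓ 0ℓ) (ι₁ : ACarrier r → Group.Carrier H₁) (s₁ : Group.Carrier H₁) →
    IsPresentation p n r ℓ c H₁ ι₁ s₁ →
    (φ₁ : Group.Carrier H₁ → ℤ) → IsProjection p n r H₁ ι₁ s₁ φ₁ →
    (H₂ : Group 0ℓ 0ℓ) (ι₂ : ACarrier r → Group.Carrier H₂) (s₂ : Group.Carrier H₂) →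
    IsPresentation p n r ℓ (dVec p n r ℓ c) H₂ ι₂ s₂ →
    (φ₂ : Group.Carrier H₂ → ℤ) → IsProjection p n r H₂ ι₂ s₂ φ₂ →
    Σ (Group.Carrier H₁ → Group.Carrier H₂) λ ψ →
        IsGroupIsomorphism (Group.rawGroup H₁) (Group.rawGroup H₂) ψ
      × (∀ x → φ₂ (ψ x) ≡ℤ φ₁ x [mod p ^ n ])
lemma3p3 p n r p-prime ℓ _ ℓ≤p^n c H₁ ι₁ s₁ pres₁ φ₁ φ₁-proj H₂ ι₂ s₂ pres₂ φ₂ φ₂-proj =
  let -c : Fin r → ℕ
      -c i = pred p * c i
      ψ , ψ-iso , ψ∘ι₁≈ι₂ , ψs₁≈ι₂∙s₂ =
        twistIsomorphism {n = n} pres₁ pres₂ (gen r -c) (gen r c)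
          (-c-twists-c-to-d p-prime {n = n} ℓ≤p^n c) (c-twists-d-to-c p-prime {n = n} ℓ≤p^n c)
          (gen[-c]+gen[c]≡0 p-prime {n = n} ℓ≤p^n c)
  in ψ , ψ-iso , projection-compatible {n = n} pres₁ φ₁ φ₁-proj {H₂ = H₂} φ₂ φ₂-proj
                   (IsGroupIsomorphism.isGroupHomomorphism ψ-iso) ψ∘ι₁≈ι₂ ψs₁≈ι₂∙s₂
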